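{- For any positive integers $a_1,\dots,a_g,b_1,\dots,b_f$, $$48\sum_{j=1}^{g} j\left(\binom{a_j}{3}+1\right) + 48\sum_{j=1}^{f} j\left(\binom{b_j}{3}+1\right) \ \ge\ \sum_{j=1}^{g} a_j\cdot\sum_{j=1}^{f} b_j .$$ -}

module Defs where

open import Data.Nat using (ℕ; zero; suc; _+_; _*_)
open import Data.Fin using (Fin; zero; suc; toℕ)

-- Σ_{i : Fin n} f i   (i.e. Σ_{j=1}^{n} f(j) with j = toℕ i + 1)
sumFin : (n : ℕ) → (Fin n → ℕ) → ℕ
sumFin zero    f = 0
sumFin (suc n) f = f zero + sumFin n (λ i → f (suc i))

{-# OPTIONS --safe #-}
-- Write each a_j as the sum over t ≥ 1 of the indicators [a_j ≥ t]. The level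
-- {j : a_j ≥ t} consists of N_t distinct indices, so Σ j over it is at least N_t²/2.
-- Cauchy–Schwarz across the levels, with weights (t+m)(t+m+1) whose reciprocals
-- telescope to 1/(m+1), gives (m+1)(Σ a_j)² ≤ 2 Σ j·D_m(a_j) where
-- D_m(v) = Σ_{k<v} (m+1+k)(m+2+k); for m = 0 this is 2·C(v+2,3). Applied to a_j ∸ 2
-- it yields (Σ a_j)² ≤ 16 Σ j (C(a_j,3) + 1), and 2AB ≤ A² + B² finishes.
module Submission where

open import Defs
open import Data.Nat using (ℕ; zero; suc; _+_; _*_; _∸_; _⊓_; _≤_; _<_; z≤n; s≤s)
open import Data.Nat.Properties
open import Data.Nat.Combinatorics using (_C_; nCk+nC[k+1]≡[n+1]C[k+1]; nC1≡n)
open import Data.Nat.Tactic.RingSolver using (solve)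
import Algebra.Properties.CommutativeSemigroup as CommutativeSemigroupProperties
open import Data.Fin using (Fin; toℕ)
open import Data.List using (_∷_; [])
open import Function using (_∘_)
open import Relation.Binary.PropositionalEquality

module +-CS = CommutativeSemigroupProperties +-commutativeSemigroup
module *-CS = CommutativeSemigroupProperties *-commutativeSemigroup

sumFin-cong : ∀ n {f h : Fin n → ℕ} → (∀ i → f i ≡ h i) → sumFin n f ≡ sumFin n h
sumFin-cong zero    f≡h = refl
sumFin-cong (suc n) f≡h = cong₂ _+_ (f≡h Fin.zero) (sumFin-cong n (f≡h ∘ Fin.suc))

sumFin-+ : ∀ n (f h : Fin n → ℕ) → sumFin n (λ i → f i + h i) ≡ sumFin n f + sumFin n h
sumFin-+ zero    f h = refl
sumFin-+ (suc n) f h = trans (cong (f Fin.zero + h Fin.zero +_) (sumFin-+ n (f ∘ Fin.suc) (h ∘ Fin.suc)))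
                             (+-CS.interchange (f Fin.zero) (h Fin.zero) _ _)

sumFin-*ˡ : ∀ n c (f : Fin n → ℕ) → sumFin n (λ i → c * f i) ≡ c * sumFin n f
sumFin-*ˡ zero    c f = sym (*-zeroʳ c)
sumFin-*ˡ (suc n) c f =
  trans (cong (c * f Fin.zero +_) (sumFin-*ˡ n c (f ∘ Fin.suc))) (sym (*-distribˡ-+ c _ _))

sumFin-mono-≤ : ∀ n {f h : Fin n → ℕ} → (∀ i → f i ≤ h i) → sumFin n f ≤ sumFin n h
sumFin-mono-≤ zero    f≤h = z≤n
sumFin-mono-≤ (suc n) f≤h = +-mono-≤ (f≤h Fin.zero) (sumFin-mono-≤ n (f≤h ∘ Fin.suc))

sumFin-zero : ∀ n {f : Fin n → ℕ} → (∀ i → f i ≡ 0) → sumFin n f ≡ 0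
sumFin-zero zero    f≡0 = refl
sumFin-zero (suc n) f≡0 = cong₂ _+_ (f≡0 Fin.zero) (sumFin-zero n (f≡0 ∘ Fin.suc))

≤-sumFin : ∀ n (f : Fin n → ℕ) i → f i ≤ sumFin n f
≤-sumFin (suc n) f Fin.zero    = m≤m+n _ _
≤-sumFin (suc n) f (Fin.suc i) = ≤-trans (≤-sumFin n (f ∘ Fin.suc) i) (m≤n+m _ _)

weightedSum : (n : ℕ) → (Fin n → ℕ) → ℕ
weightedSum n f = sumFin n (λ i → suc (toℕ i) * f i)

weightedSum-cong : ∀ n {f h : Fin n → ℕ} → (∀ i → f i ≡ h i) → weightedSum n f ≡ weightedSum n h
weightedSum-cong n f≡h = sumFin-cong n (λ i → cong (suc (toℕ i) *_) (f≡h i))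

weightedSum-+ : ∀ n (f h : Fin n → ℕ) →
                weightedSum n (λ i → f i + h i) ≡ weightedSum n f + weightedSum n h
weightedSum-+ n f h =
  trans (sumFin-cong n (λ i → *-distribˡ-+ (suc (toℕ i)) (f i) (h i))) (sumFin-+ n _ _)

weightedSum-*ˡ : ∀ n c (f : Fin n → ℕ) → weightedSum n (λ i → c * f i) ≡ c * weightedSum n f
weightedSum-*ˡ n c f =
  trans (sumFin-cong n (λ i → *-CS.x∙yz≈y∙xz (suc (toℕ i)) c (f i))) (sumFin-*ˡ n c _)

weightedSum-suc : ∀ n (f : Fin (suc n) → ℕ) → weightedSum (suc n) f
                  ≡ f Fin.zero + (sumFin n (f ∘ Fin.suc) + weightedSum n (f ∘ Fin.suc))
weightedSum-suc n f = cong₂ _+_ (*-identityˡ (f Fin.zero)) (sumFin-+ n (f ∘ Fin.suc) _)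

2*m*n≤m*m+n*n : ∀ m n → 2 * (m * n) ≤ m * m + n * n
2*m*n≤m*m+n*n zero    n       = z≤n
2*m*n≤m*m+n*n (suc m) zero    rewrite *-zeroʳ (suc m) = z≤n
2*m*n≤m*m+n*n (suc m) (suc n) = begin
    2 * (suc m * suc n)               ≡⟨ solve (m ∷ n ∷ []) ⟩
    2 * (m * n) + 2 * (m + n + 1)     ≤⟨ +-monoˡ-≤ _ (2*m*n≤m*m+n*n m n) ⟩
    m * m + n * n + 2 * (m + n + 1)   ≡⟨ solve (m ∷ n ∷ []) ⟩
    suc m * suc m + suc n * suc n     ∎
  where open ≤-Reasoning

[m+n]²≤2*[m²+n²] : ∀ m n → (m + n) * (m + n) ≤ 2 * (m * m + n * n)
[m+n]²≤2*[m²+n²] m n = begin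
    (m + n) * (m + n)                    ≡⟨ solve (m ∷ n ∷ []) ⟩
    m * m + n * n + 2 * (m * n)          ≤⟨ +-monoʳ-≤ (m * m + n * n) (2*m*n≤m*m+n*n m n) ⟩
    m * m + n * n + (m * m + n * n)      ≡⟨ solve (m ∷ n ∷ []) ⟩
    2 * (m * m + n * n)                  ∎
  where open ≤-Reasoning

-- Distinct indices: the N indices with e i = 1 contribute at least 1 + 2 + ⋯ + N.
sumFin²≤2*weightedSum : ∀ n (e : Fin n → ℕ) → (∀ i → e i ≤ 1) →
                        sumFin n e * sumFin n e ≤ 2 * weightedSum n e
sumFin²≤2*weightedSum zero    e e≤1 = z≤n
sumFin²≤2*weightedSum (suc n) e e≤1 = begin
    (e Fin.zero + N) * (e Fin.zero + N) ≤⟨ step (e≤1 Fin.zero) N²≤2W ⟩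
    2 * (e Fin.zero + (N + W))          ≡⟨ cong (2 *_) (weightedSum-suc n e) ⟨
    2 * weightedSum (suc n) e           ∎
  where
  open ≤-Reasoning
  N = sumFin n (e ∘ Fin.suc)
  W = weightedSum n (e ∘ Fin.suc)
  N²≤2W : N * N ≤ 2 * W
  N²≤2W = sumFin²≤2*weightedSum n (e ∘ Fin.suc) (e≤1 ∘ Fin.suc)
  step : ∀ {x N W} → x ≤ 1 → N * N ≤ 2 * W → (x + N) * (x + N) ≤ 2 * (x + (N + W))
  step {N = N} {W} z≤n N²≤2W = ≤-trans N²≤2W (*-monoʳ-≤ 2 (m≤n+m W N))
  step {N = N} {W} (s≤s z≤n) N²≤2W = begin
    suc N * suc N         ≡⟨ solve (N ∷ []) ⟩
    1 + 2 * N + N * N     ≤⟨ +-monoʳ-≤ (1 + 2 * N) N²≤2W ⟩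
    1 + 2 * N + 2 * W     ≤⟨ n≤1+n _ ⟩
    2 + 2 * N + 2 * W     ≡⟨ solve (N ∷ W ∷ []) ⟩
    2 * (1 + (N + W))     ∎

-- Cauchy–Schwarz with weights (m+1)(m+2) and m+2, using 1/(m+1) = 1/((m+1)(m+2)) + 1/(m+2).
telescoping-≤ : ∀ m x y →
                suc m * ((x + y) * (x + y)) ≤ (2 + m) * suc m * (x * x) + (2 + m) * (y * y)
telescoping-≤ m x y = begin
    suc m * ((x + y) * (x + y))
      ≡⟨ solve (m ∷ x ∷ y ∷ []) ⟩
    suc m * (x * x) + suc m * (y * y) + 2 * (suc m * x * y)
      ≤⟨ +-monoʳ-≤ (suc m * (x * x) + suc m * (y * y)) (2*m*n≤m*m+n*n (suc m * x) y) ⟩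
    suc m * (x * x) + suc m * (y * y) + (suc m * x * (suc m * x) + y * y)
      ≡⟨ solve (m ∷ x ∷ y ∷ []) ⟩
    (2 + m) * suc m * (x * x) + (2 + m) * (y * y)
      ∎
  where open ≤-Reasoning

consecutiveProducts : ℕ → ℕ → ℕ
consecutiveProducts m zero    = 0
consecutiveProducts m (suc v) = (2 + m) * suc m + consecutiveProducts (suc m) v

consecutiveProducts-peel : ∀ m v → consecutiveProducts m v
                           ≡ (2 + m) * suc m * (1 ⊓ v) + consecutiveProducts (suc m) (v ∸ 1)
consecutiveProducts-peel m zero    = sym (cong (_+ 0) (*-zeroʳ ((2 + m) * suc m)))
consecutiveProducts-peel m (suc v) =
  sym (cong (_+ consecutiveProducts (suc m) v) (*-identityʳ ((2 + m) * suc m)))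

-- K bounds the number of levels {i : b i ≥ t}, which are peeled off one at a time.
[1+m]*sumFin²≤2*weightedSum : ∀ K m n (b : Fin n → ℕ) → (∀ i → b i ≤ K) →
  suc m * (sumFin n b * sumFin n b) ≤ 2 * weightedSum n (consecutiveProducts m ∘ b)
[1+m]*sumFin²≤2*weightedSum zero m n b b≤0
  rewrite sumFin-zero n (n≤0⇒n≡0 ∘ b≤0) | *-zeroʳ (suc m) = z≤n
[1+m]*sumFin²≤2*weightedSum (suc K) m n b b≤1+K = begin
    suc m * (sumFin n b * sumFin n b)     ≡⟨ cong (λ s → suc m * (s * s)) sumFin-split ⟩
    suc m * ((N + R) * (N + R))           ≤⟨ telescoping-≤ m N R ⟩
    w * (N * N) + (2 + m) * (R * R)       ≤⟨ +-mono-≤ (*-monoʳ-≤ w bottom) rest ⟩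
    w * (2 * W) + 2 * S                   ≡⟨ cong (_+ 2 * S) (*-CS.x∙yz≈y∙xz w 2 W) ⟩
    2 * (w * W) + 2 * S                   ≡⟨ *-distribˡ-+ 2 (w * W) S ⟨
    2 * (w * W + S)                       ≡⟨ cong (2 *_) weightedSum-split ⟨
    2 * weightedSum n (consecutiveProducts m ∘ b) ∎
  where
  open ≤-Reasoning
  w = (2 + m) * suc m
  e r : Fin n → ℕ
  e i = 1 ⊓ b i
  r i = b i ∸ 1
  N = sumFin n e
  R = sumFin n r
  W = weightedSum n e
  S = weightedSum n (consecutiveProducts (suc m) ∘ r)
  bottom : N * N ≤ 2 * W
  bottom = sumFin²≤2*weightedSum n e (λ i → m⊓n≤m 1 (b i))
  rest : (2 + m) * (R * R) ≤ 2 * S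
  rest = [1+m]*sumFin²≤2*weightedSum K (suc m) n r (λ i → ∸-monoˡ-≤ 1 (b≤1+K i))
  sumFin-split : sumFin n b ≡ N + R
  sumFin-split = trans (sumFin-cong n (λ i → sym (m⊓n+n∸m≡n 1 (b i)))) (sumFin-+ n e r)
  weightedSum-split : weightedSum n (consecutiveProducts m ∘ b) ≡ w * W + S
  weightedSum-split = begin-equality
    weightedSum n (consecutiveProducts m ∘ b)   ≡⟨ weightedSum-cong n (consecutiveProducts-peel m ∘ b) ⟩
    weightedSum n (λ i → w * e i + consecutiveProducts (suc m) (r i))
                                                ≡⟨ weightedSum-+ n _ _ ⟩
    weightedSum n (λ i → w * e i) + S           ≡⟨ cong (_+ S) (weightedSum-*ˡ n w e) ⟩
    w * W + S                                   ∎

2*[1+n]C2≡[1+n]*n : ∀ n → 2 * (suc n C 2) ≡ suc n * n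
2*[1+n]C2≡[1+n]*n zero    = refl
2*[1+n]C2≡[1+n]*n (suc n) = begin
    2 * ((2 + n) C 2)             ≡⟨ cong (2 *_) (nCk+nC[k+1]≡[n+1]C[k+1] (suc n) 1) ⟨
    2 * (suc n C 1 + suc n C 2)   ≡⟨ cong (λ k → 2 * (k + suc n C 2)) (nC1≡n (suc n)) ⟩
    2 * (suc n + suc n C 2)       ≡⟨ *-distribˡ-+ 2 (suc n) _ ⟩
    2 * suc n + 2 * (suc n C 2)   ≡⟨ cong (2 * suc n +_) (2*[1+n]C2≡[1+n]*n n) ⟩
    2 * suc n + suc n * n         ≡⟨ solve (n ∷ []) ⟩
    (2 + n) * suc n               ∎
  where open ≡-Reasoning

[1+n]*n+2*[1+n]C3≡2*[2+n]C3 : ∀ n → suc n * n + 2 * (suc n C 3) ≡ 2 * ((2 + n) C 3)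
[1+n]*n+2*[1+n]C3≡2*[2+n]C3 n = begin
    suc n * n + 2 * (suc n C 3)           ≡⟨ cong (_+ 2 * (suc n C 3)) (2*[1+n]C2≡[1+n]*n n) ⟨
    2 * (suc n C 2) + 2 * (suc n C 3)     ≡⟨ *-distribˡ-+ 2 (suc n C 2) _ ⟨
    2 * (suc n C 2 + suc n C 3)           ≡⟨ cong (2 *_) (nCk+nC[k+1]≡[n+1]C[k+1] (suc n) 2) ⟩
    2 * ((2 + n) C 3)                     ∎
  where open ≡-Reasoning

consecutiveProducts-C3 : ∀ v m → consecutiveProducts m v + 2 * ((2 + m) C 3) ≡ 2 * ((v + (2 + m)) C 3)
consecutiveProducts-C3 zero    m = refl
consecutiveProducts-C3 (suc v) m = begin
    w + P + 2 * ((2 + m) C 3)       ≡⟨ +-CS.xy∙z≈y∙xz w P _ ⟩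
    P + (w + 2 * ((2 + m) C 3))     ≡⟨ cong (P +_) ([1+n]*n+2*[1+n]C3≡2*[2+n]C3 (suc m)) ⟩
    P + 2 * ((3 + m) C 3)           ≡⟨ consecutiveProducts-C3 v (suc m) ⟩
    2 * ((v + (3 + m)) C 3)         ≡⟨ cong (λ k → 2 * (k C 3)) (+-suc v (2 + m)) ⟩
    2 * ((suc v + (2 + m)) C 3)     ∎
  where
  open ≡-Reasoning
  w = (2 + m) * suc m
  P = consecutiveProducts (suc m) v

-- The shift by 2 makes the closed form exact; for a < 2 both sides vanish.
consecutiveProducts-∸2 : ∀ a → consecutiveProducts 0 (a ∸ 2) ≡ 2 * (a C 3)
consecutiveProducts-∸2 0 = refl
consecutiveProducts-∸2 1 = refl
consecutiveProducts-∸2 (suc (suc k)) = begin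
    consecutiveProducts 0 k                  ≡⟨ +-identityʳ _ ⟨
    consecutiveProducts 0 k + 2 * (2 C 3)    ≡⟨ consecutiveProducts-C3 k 0 ⟩
    2 * ((k + 2) C 3)                        ≡⟨ cong (λ n → 2 * (n C 3)) (+-comm k 2) ⟩
    2 * ((2 + k) C 3)                        ∎
  where open ≡-Reasoning

sumFin²≤16*weightedSum[C3+1] : ∀ n (a : Fin n → ℕ) →
                               sumFin n a * sumFin n a ≤ 16 * weightedSum n (λ i → a i C 3 + 1)
sumFin²≤16*weightedSum[C3+1] n a = begin
    A * A                                    ≤⟨ *-mono-≤ A≤2E+R A≤2E+R ⟩
    (2 * E + R) * (2 * E + R)                ≤⟨ combine E R G S E²≤2G R²≤4S ⟩
    16 * (S + G)                             ≡⟨ cong (16 *_) (weightedSum-+ n (λ i → a i C 3) (λ _ → 1)) ⟨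
    16 * weightedSum n (λ i → a i C 3 + 1)   ∎
  where
  open ≤-Reasoning
  combine : ∀ E R G S → E * E ≤ 2 * G → R * R ≤ 4 * S → (2 * E + R) * (2 * E + R) ≤ 16 * (S + G)
  combine E R G S E²≤2G R²≤4S = begin
    (2 * E + R) * (2 * E + R)         ≤⟨ [m+n]²≤2*[m²+n²] (2 * E) R ⟩
    2 * (2 * E * (2 * E) + R * R)     ≡⟨ solve (E ∷ R ∷ []) ⟩
    2 * (4 * (E * E) + R * R)         ≤⟨ *-monoʳ-≤ 2 (+-mono-≤ (*-monoʳ-≤ 4 E²≤2G) R²≤4S) ⟩
    2 * (4 * (2 * G) + 4 * S)         ≡⟨ solve (G ∷ S ∷ []) ⟩
    16 * G + 8 * S                    ≤⟨ +-monoʳ-≤ (16 * G) (*-monoˡ-≤ S (m≤m+n 8 8)) ⟩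
    16 * G + 16 * S                   ≡⟨ solve (G ∷ S ∷ []) ⟩
    16 * (S + G)                      ∎
  r : Fin n → ℕ
  r i = a i ∸ 2
  A = sumFin n a
  E = sumFin n (λ _ → 1)
  R = sumFin n r
  G = weightedSum n (λ _ → 1)
  S = weightedSum n (λ i → a i C 3)
  A≤2E+R : A ≤ 2 * E + R
  A≤2E+R = begin
    A                              ≤⟨ sumFin-mono-≤ n (λ i → m≤n+m∸n (a i) 2) ⟩
    sumFin n (λ i → 2 * 1 + r i)   ≡⟨ sumFin-+ n (λ _ → 2 * 1) r ⟩
    sumFin n (λ _ → 2 * 1) + R     ≡⟨ cong (_+ R) (sumFin-*ˡ n 2 (λ _ → 1)) ⟩
    2 * E + R                      ∎
  E²≤2G : E * E ≤ 2 * G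
  E²≤2G = sumFin²≤2*weightedSum n (λ _ → 1) (λ _ → ≤-refl)
  R²≤4S : R * R ≤ 4 * S
  R²≤4S = begin
    R * R                                           ≡⟨ *-identityˡ (R * R) ⟨
    1 * (R * R)                                     ≤⟨ [1+m]*sumFin²≤2*weightedSum R 0 n r (≤-sumFin n r) ⟩
    2 * weightedSum n (consecutiveProducts 0 ∘ r)   ≡⟨ cong (2 *_) closedForm ⟩
    2 * (2 * S)                                     ≡⟨ *-assoc 2 2 S ⟨
    4 * S                                           ∎
    where
    closedForm : weightedSum n (consecutiveProducts 0 ∘ r) ≡ 2 * S
    closedForm = trans (weightedSum-cong n (consecutiveProducts-∸2 ∘ a)) (weightedSum-*ˡ n 2 (λ i → a i C 3))

lemma3p8 : (g f : ℕ) (a : Fin g → ℕ) (b : Fin f → ℕ) →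
    (∀ i → 0 < a i) → (∀ i → 0 < b i) →
    sumFin g a * sumFin f b
      ≤ 48 * sumFin g (λ i → suc (toℕ i) * (a i C 3 + 1))
        + 48 * sumFin f (λ i → suc (toℕ i) * (b i C 3 + 1))
lemma3p8 g f a b _ _ = begin
    A * B                  ≤⟨ m≤n*m (A * B) 2 ⟩
    2 * (A * B)            ≤⟨ 2*m*n≤m*m+n*n A B ⟩
    A * A + B * B          ≤⟨ +-mono-≤ (sumFin²≤16*weightedSum[C3+1] g a) (sumFin²≤16*weightedSum[C3+1] f b) ⟩
    16 * Tₐ + 16 * T_b     ≤⟨ +-mono-≤ (*-monoˡ-≤ Tₐ 16≤48) (*-monoˡ-≤ T_b 16≤48) ⟩
    48 * Tₐ + 48 * T_b     ∎
  where
  open ≤-Reasoning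
  A = sumFin g a
  B = sumFin f b
  Tₐ = weightedSum g (λ i → a i C 3 + 1)
  T_b = weightedSum f (λ i → b i C 3 + 1)
  16≤48 : 16 ≤ 48
  16≤48 = m≤m+n 16 32
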